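{- Let $\mathcal{U}$ be the set of all partitions, $\mathcal{D}$ the set of partitions into distinct parts, and $\mathcal{K}$ the set of partitions $\pi=(\lambda_1,\dots,\lambda_{\nu(\pi)})$ such that $\lambda_i-\lambda_{i+1}\le2$ for all $1\le i\le\nu(\pi)-1$ and the smallest part satisfies $\lambda_{\nu(\pi)}\le 2$ (the empty partition included), where $\nu(\pi)$ is the number of parts. For $\pi=(\lambda_1,\lambda_2,\dots)$ let $\mathcal{O}(\pi)=\lambda_1+\lambda_3+\cdots$ and let $\pi'$ be the conjugate of $\pi$. For nonempty $\pi$ define \[\omega_{0,0}(\pi)=(\lambda_{\nu(\pi)}+1)\prod_{i=1}^{\nu(\pi)-1}(\lambda_i-\lambda_{i+1}+1),\qquad \hat\omega_1(\pi)=2^{\mathrm{par}(\lambda_{\nu(\pi)})}\prod_{i=1}^{\nu(\pi)-1}2^{\mathrm{par}(\lambda_i-\lambda_{i+1})},\] where $\mathrm{par}(n)=0$ if $n$ is even and $1$ if $n$ is odd, and let both weights equal $1$ on the empty partition. Then \[\sum_{\pi\in\mathcal{U}}q^{\mathcal{O}(\pi)}=\sum_{\pi\in\mathcal{U}}\omega_{0,0}(\pi)\,q^{|\pi|},\qquad \sum_{\pi\in\mathcal{D}}q^{\mathcal{O}(\pi')}=\sum_{\pi\in\mathcal{K}}\hat\omega_1(\pi)\,q^{|\pi|}.\]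
   Context: A partition is a finite weakly decreasing sequence of positive integers; $|\pi|$ is the sum of its parts. The conjugate $\pi'$ has $j$-th part equal to the number of parts of $\pi$ that are $\ge j$. -}

module Defs where

open import Data.Nat using (ℕ; zero; suc; _+_; _*_; _∸_; _^_; _≤_; _<_; _>_; _≥_; _≤?_; _⊔_)
open import Data.Nat.DivMod using (_%_)
open import Data.List using (List; []; _∷_; length; map; filter; upTo; foldr)
open import Data.Nat.ListAction using (sum)
open import Data.List.Relation.Unary.All using (All)
open import Data.List.Relation.Unary.Linked using (Linked)
open import Data.List.Relation.Unary.Unique.Propositional using (Unique)
open import Data.List.Membership.Propositional using (_∈_)
open import Data.Product using (_×_; Σ-syntax)
open import Data.Unit using (⊤)
open import Function.Bundles using (_⇔_)
open import Relation.Binary.PropositionalEquality using (_≡_)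

IsPartition : List ℕ → Set
IsPartition π = Linked _≥_ π × All (λ x → 0 < x) π

size : List ℕ → ℕ
size = sum

mutual
  oddSum : List ℕ → ℕ
  oddSum []       = 0
  oddSum (x ∷ xs) = x + evenSum xs

  evenSum : List ℕ → ℕ
  evenSum []       = 0
  evenSum (x ∷ xs) = oddSum xs

O : List ℕ → ℕ
O = oddSum

conj : List ℕ → List ℕ
conj π = map (λ j → length (filter (λ x → j ≤? x) π))
             (map suc (upTo (foldr _⊔_ 0 π)))

IsDistinct : List ℕ → Set
IsDistinct π = IsPartition π × Linked _>_ π

SmallestAtMost2 : List ℕ → Set
SmallestAtMost2 []           = ⊤
SmallestAtMost2 (x ∷ [])     = x ≤ 2
SmallestAtMost2 (x ∷ y ∷ r)  = SmallestAtMost2 (y ∷ r)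

InK : List ℕ → Set
InK π = IsPartition π × Linked (λ a b → a ∸ b ≤ 2) π × SmallestAtMost2 π

par : ℕ → ℕ
par n = n % 2

ω00 : List ℕ → ℕ
ω00 []          = 1
ω00 (x ∷ [])    = x + 1
ω00 (x ∷ y ∷ r) = (x ∸ y + 1) * ω00 (y ∷ r)

ωhat1 : List ℕ → ℕ
ωhat1 []          = 1
ωhat1 (x ∷ [])    = 2 ^ par x
ωhat1 (x ∷ y ∷ r) = 2 ^ par (x ∸ y) * ωhat1 (y ∷ r)

Enumerates : (List ℕ → Set) → List (List ℕ) → Set
Enumerates P L = Unique L × (∀ π → (π ∈ L) ⇔ P π)

-- Coefficient of q^n agrees in  Σ_{π ∈ A} q^{f π}  and  Σ_{π ∈ B} w(π) q^{|π|}: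
-- both index sets are finite, and #{π ∈ A | f π = n} = Σ_{π ∈ B, |π| = n} w π.
CoeffEq : (A : List ℕ → Set) (f : List ℕ → ℕ)
          (B : List ℕ → Set) (w : List ℕ → ℕ) → ℕ → Set
CoeffEq A f B w n =
  Σ[ L₁ ∈ List (List ℕ) ] Σ[ L₂ ∈ List (List ℕ) ]
    ( Enumerates (λ π → A π × f π ≡ n) L₁
    × Enumerates (λ π → B π × size π ≡ n) L₂
    × length L₁ ≡ sum (map w L₂))

module Submission where

-- We prove them by
-- "counting by fibres": if every object z on the left has a base `base z` on the
-- right whose size is the statistic of z, and the objects over a base b are
-- exactly the w(b) entries of an explicit duplicate-free list, then concatenating
-- these fibres over an enumeration of the bases of size n enumerates the left side
-- and has length Σ w(b)  (Fibration, coeffEq-fibration).  Finiteness of the sets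
-- of size n comes from filtering the bounded lists (enumerate-bySize).
--
-- First identity: a partition fibres over its odd-indexed parts (λ₁, λ₃, …); the
-- even-indexed parts are free in the gaps, giving ω₀₀ choices (oddsFibration).
-- Second identity: conjugation is an involution (conj-involutive) exchanging
-- partitions into distinct parts with compact partitions (last part 1, rises of
-- 0 or 1); compact partitions fibre over their odd-indexed parts, which form
-- exactly the set 𝒦, with ω̂₁ choices (conjOddsFibration).

open import Defs
open import Data.Nat using (ℕ; zero; suc; _+_; _*_; _∸_; _^_; _≤_; _<_; _≥_; _>_; _⊔_; _≟_; _≤?_; _<?_; _≥?_; z≤n; s≤s)
open import Data.Nat.Properties
open import Data.Nat.ListAction using (sum)
open import Data.List
  using (List; []; _∷_; _++_; length; map; filter; concatMap; cartesianProductWith; applyUpTo; upTo; foldr; replicate)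
open import Data.List.Properties
  using ( length-++; length-map; length-applyUpTo; ∷-injective; ∷-injectiveʳ; map-cong-local; map-∘
        ; map-upTo; map-applyUpTo; filter-accept; filter-reject; filter-all; filter-none; filter-++)
open import Data.List.Relation.Unary.All as All using (All; []; _∷_; all?)
open import Data.List.Relation.Unary.Any using (here; there)
open import Data.List.Relation.Unary.Any.Properties using (applyUpTo⁺; applyUpTo⁻)
open import Data.List.Relation.Unary.Linked as Linked using (Linked; []; [-]; _∷_; linked?)
open import Data.List.Relation.Unary.Unique.Propositional using (Unique; []; _∷_)
import Data.List.Relation.Unary.Unique.Propositional.Properties as Unique
open import Data.List.Membership.Propositional using (_∈_; find; lose)
open import Data.List.Membership.Propositional.Properties
  using ( ∈-map⁺; ∈-map⁻; ∈-concatMap⁺; ∈-concatMap⁻; ∈-cartesianProductWith⁺; ∈-cartesianProductWith⁻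
        ; ∈-filter⁺; ∈-filter⁻)
open import Data.Product using (_×_; _,_; proj₁; proj₂; Σ-syntax)
open import Data.Unit using (tt)
open import Data.Empty using (⊥)
open import Function using (_∘_)
open import Function.Bundles using (_⇔_; mk⇔; Equivalence)
open import Relation.Binary.PropositionalEquality
open import Relation.Nullary using (yes; no)
open import Relation.Nullary.Decidable using (_×-dec_)
open import Relation.Unary using (Decidable)

length-cartesianProductWith : {A B C : Set} (f : A → B → C) (xs : List A) (ys : List B) →
  length (cartesianProductWith f xs ys) ≡ length xs * length ys
length-cartesianProductWith f [] ys = refl
length-cartesianProductWith f (x ∷ xs) ys = begin
  length (map (f x) ys ++ cartesianProductWith f xs ys)
    ≡⟨ length-++ (map (f x) ys) ⟩
  length (map (f x) ys) + length (cartesianProductWith f xs ys)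
    ≡⟨ cong₂ _+_ (length-map (f x) ys) (length-cartesianProductWith f xs ys) ⟩
  length ys + length xs * length ys ∎
  where open ≡-Reasoning

length-concatMap : {A B : Set} (f : A → List B) (xs : List A) →
  length (concatMap f xs) ≡ sum (map (length ∘ f) xs)
length-concatMap f [] = refl
length-concatMap f (x ∷ xs) =
  trans (length-++ (f x)) (cong (length (f x) +_) (length-concatMap f xs))

Unique-concatMap : {A B : Set} (f : A → List B) (key : B → A) {xs : List A} →
  Unique xs → (∀ {x} → x ∈ xs → Unique (f x)) →
  (∀ {x z} → x ∈ xs → z ∈ f x → key z ≡ x) → Unique (concatMap f xs)
Unique-concatMap f key [] _ _ = []
Unique-concatMap f key {x ∷ xs} (x∉xs ∷ uxs) uf keyed =
  Unique.++⁺ (uf (here refl)) (Unique-concatMap f key uxs (uf ∘ there) (keyed ∘ there)) disjoint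
  where
  disjoint : ∀ {z} → z ∈ f x × z ∈ concatMap f xs → ⊥
  disjoint (z∈fx , z∈rest) with find (∈-concatMap⁻ f z∈rest)
  ... | y , y∈xs , z∈fy =
    All.lookup x∉xs y∈xs (trans (sym (keyed (here refl) z∈fx)) (keyed (there y∈xs) z∈fy))

Unique-map-injectiveOn : {A B : Set} (f : A → B) {xs : List A} →
  (∀ {x y} → x ∈ xs → y ∈ xs → f x ≡ f y → x ≡ y) → Unique xs → Unique (map f xs)
Unique-map-injectiveOn f inj [] = []
Unique-map-injectiveOn f {x ∷ xs} inj (x∉xs ∷ uxs) =
  All.tabulate fresh ∷ Unique-map-injectiveOn f (λ p q → inj (there p) (there q)) uxs
  where
  fresh : ∀ {v} → v ∈ map f xs → f x ≢ v
  fresh v∈ fx≡v with ∈-map⁻ f v∈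
  ... | y , y∈xs , refl = All.lookup x∉xs y∈xs (inj (here refl) (there y∈xs) fx≡v)

record Fibration (A B : List ℕ → Set) (w : List ℕ → ℕ) : Set where
  field
    base           : List ℕ → List ℕ
    fibre          : List ℕ → List (List ℕ)
    fibre-sound    : ∀ {b z} → B b → z ∈ fibre b → A z × base z ≡ b
    fibre-complete : ∀ {z} → A z → B (base z) × z ∈ fibre (base z)
    fibre-unique   : ∀ {b} → B b → Unique (fibre b)
    fibre-size     : ∀ {b} → B b → length (fibre b) ≡ w b

coeffEq-fibration : ∀ {A B w} (F : Fibration A B w) (f : List ℕ → ℕ) →
  (∀ {z} → A z → f z ≡ size (Fibration.base F z)) →
  ∀ n {L} → Enumerates (λ π → B π × size π ≡ n) L → CoeffEq A f B w n
coeffEq-fibration {A} {B} {w} F f f≡size n {L} (uniqueL , memberL) =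
  concatMap fibre L , L , (unique , member) , (uniqueL , memberL) , count
  where
  open Fibration F
  inL : ∀ {b} → b ∈ L → B b × size b ≡ n
  inL = Equivalence.to (memberL _)
  unique : Unique (concatMap fibre L)
  unique = Unique-concatMap fibre base uniqueL (fibre-unique ∘ proj₁ ∘ inL)
             (λ b∈L → proj₂ ∘ fibre-sound (proj₁ (inL b∈L)))
  sound : ∀ {z} → z ∈ concatMap fibre L → A z × f z ≡ n
  sound z∈ with find (∈-concatMap⁻ fibre z∈)
  ... | b , b∈L , z∈fb with inL b∈L
  ... | Bb , size≡n with fibre-sound Bb z∈fb
  ... | Az , refl = Az , trans (f≡size Az) size≡n
  complete : ∀ {z} → A z × f z ≡ n → z ∈ concatMap fibre L
  complete (Az , fz≡n) with fibre-complete Az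
  ... | Bbase , z∈fibre =
    ∈-concatMap⁺ fibre (lose (Equivalence.from (memberL _) (Bbase , trans (sym (f≡size Az)) fz≡n)) z∈fibre)
  member : ∀ z → (z ∈ concatMap fibre L) ⇔ (A z × f z ≡ n)
  member z = mk⇔ sound complete
  count : length (concatMap fibre L) ≡ sum (map w L)
  count = trans (length-concatMap fibre L)
            (cong sum (map-cong-local (All.tabulate (fibre-size ∘ proj₁ ∘ inL))))

interval : ℕ → ℕ → List ℕ
interval y k = applyUpTo (_+ y) (suc k)

length-interval : ∀ y k → length (interval y k) ≡ suc k
length-interval y k = length-applyUpTo (_+ y) (suc k)

∈-interval⁺ : ∀ {y k m} → y ≤ m → m ≤ k + y → m ∈ interval y k
∈-interval⁺ {y} {k} {m} y≤m m≤k+y =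
  applyUpTo⁺ (_+ y) (sym (m∸n+n≡m y≤m)) (s≤s (m≤n+o⇒m∸n≤o m y (≤-trans m≤k+y (≤-reflexive (+-comm k y)))))

∈-interval⁻ : ∀ {y k m} → m ∈ interval y k → y ≤ m × m ≤ k + y
∈-interval⁻ {y} {k} m∈ with applyUpTo⁻ (_+ y) m∈
... | i , s≤s i≤k , refl = m≤n+m y i , +-monoˡ-≤ y i≤k

Unique-interval : ∀ y k → Unique (interval y k)
Unique-interval y k = Unique.applyUpTo⁺₁ (_+ y) (suc k) (λ i<j _ → <⇒≢ i<j ∘ +-cancelʳ-≡ y _ _)

boundedLists : ℕ → ℕ → List (List ℕ)
boundedLists b zero    = [] ∷ []
boundedLists b (suc m) = [] ∷ cartesianProductWith _∷_ (upTo (suc b)) (boundedLists b m)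

Unique-boundedLists : ∀ b m → Unique (boundedLists b m)
Unique-boundedLists b zero    = [] ∷ []
Unique-boundedLists b (suc m) =
  All.tabulate nonEmpty ∷ Unique.cartesianProductWith⁺ _∷_ ∷-injective (Unique.upTo⁺ (suc b)) (Unique-boundedLists b m)
  where
  nonEmpty : ∀ {v} → v ∈ cartesianProductWith _∷_ (upTo (suc b)) (boundedLists b m) → [] ≢ v
  nonEmpty v∈ with ∈-cartesianProductWith⁻ _∷_ (upTo (suc b)) (boundedLists b m) v∈
  ... | _ , _ , _ , _ , refl = λ ()

∈-boundedLists : ∀ {b} m {π} → length π ≤ m → All (_≤ b) π → π ∈ boundedLists b m
∈-boundedLists zero    {[]}    _         _          = here refl
∈-boundedLists (suc m) {[]}    _         _          = here refl
∈-boundedLists (suc m) {x ∷ π} (s≤s len) (x≤b ∷ π≤b) =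
  there (∈-cartesianProductWith⁺ _∷_ (applyUpTo⁺ (λ i → i) refl (s≤s x≤b)) (∈-boundedLists m len π≤b))

length≤sum : ∀ {π} → All (0 <_) π → length π ≤ sum π
length≤sum []        = z≤n
length≤sum (p ∷ ps) = +-mono-≤ p (length≤sum ps)

entries≤sum : ∀ π → All (_≤ sum π) π
entries≤sum []      = []
entries≤sum (x ∷ π) = m≤m+n x (sum π) ∷ All.map (λ y≤ → ≤-trans y≤ (m≤n+m (sum π) x)) (entries≤sum π)

-- Finiteness: a decidable property of lists of positive integers has finitely many
-- instances of each size n, all of them among the bounded lists of length ≤ n and entries ≤ n.
enumerate-bySize : ∀ {P : List ℕ → Set} → Decidable P → (∀ {π} → P π → All (0 <_) π) →
  ∀ n → Σ[ L ∈ List (List ℕ) ] Enumerates (λ π → P π × size π ≡ n) L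
enumerate-bySize {P} P? positive n =
  filter Pn? (boundedLists n n) ,
  Unique.filter⁺ Pn? {boundedLists n n} (Unique-boundedLists n n) ,
  λ π → mk⇔ (proj₂ ∘ ∈-filter⁻ Pn? {xs = boundedLists n n}) (λ Pπ → ∈-filter⁺ Pn? (bounded Pπ) Pπ)
  where
  Pn? : Decidable (λ π → P π × size π ≡ n)
  Pn? π = P? π ×-dec (size π ≟ n)
  bounded : ∀ {π} → P π × size π ≡ n → π ∈ boundedLists n n
  bounded {π} (Pπ , refl) = ∈-boundedLists (sum π) (length≤sum (positive Pπ)) (entries≤sum π)

mutual
  odds : List ℕ → List ℕ
  odds []       = []
  odds (x ∷ xs) = x ∷ evens xs

  evens : List ℕ → List ℕ
  evens []       = []
  evens (x ∷ xs) = odds xs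

mutual
  oddSum≡size-odds : ∀ π → oddSum π ≡ size (odds π)
  oddSum≡size-odds []      = refl
  oddSum≡size-odds (x ∷ π) = cong (x +_) (evenSum≡size-evens π)

  evenSum≡size-evens : ∀ π → evenSum π ≡ size (evens π)
  evenSum≡size-evens []      = refl
  evenSum≡size-evens (x ∷ π) = oddSum≡size-odds π

odds-head : ∀ {t y r} → odds t ≡ y ∷ r → Σ[ t′ ∈ List ℕ ] t ≡ y ∷ t′
odds-head {x ∷ t} refl = t , refl

isPartition? : Decidable IsPartition
isPartition? π = linked? (λ x y → x ≥? y) π ×-dec all? (0 <?_) π

partition-[] : IsPartition []
partition-[] = [] , []

partition-tail : ∀ {x π} → IsPartition (x ∷ π) → IsPartition π
partition-tail (ordered , _ ∷ positive) = Linked.tail ordered , positive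

partition-cons : ∀ {x y π} → y ≤ x → IsPartition (y ∷ π) → IsPartition (x ∷ y ∷ π)
partition-cons y≤x (ordered , y>0 ∷ positive) = (y≤x ∷ ordered) , ≤-trans y>0 y≤x ∷ y>0 ∷ positive

prepend₂-injective : ∀ (x : ℕ) {m m′ : ℕ} {t t′ : List ℕ} → x ∷ m ∷ t ≡ x ∷ m′ ∷ t′ → m ≡ m′ × t ≡ t′
prepend₂-injective x = ∷-injective ∘ ∷-injectiveʳ

-- m ≤ x rewritten with x as  (x ∸ w) + w, the top of  interval w (x ∸ w).
≤-top : ∀ {m w x} → w ≤ x → m ≤ x → m ≤ x ∸ w + w
≤-top w≤x m≤x = ≤-trans m≤x (≤-reflexive (sym (m∸n+n≡m w≤x)))

top-≤ : ∀ {m w x} → w ≤ x → m ≤ x ∸ w + w → m ≤ x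
top-≤ w≤x m≤top = ≤-trans m≤top (≤-reflexive (m∸n+n≡m w≤x))

-- The partitions with odd-indexed parts b = (b₁, b₂, …): between consecutive odd parts
-- x ≥ y the even part ranges over [y, x], and after the last odd part x there is
-- either nothing or one part in [1, x].  This gives ω₀₀(b) choices.
oddsFibre : List ℕ → List (List ℕ)
oddsFibre []          = [] ∷ []
oddsFibre (x ∷ [])    = (x ∷ []) ∷ map (λ m → x ∷ m ∷ []) (interval 1 (x ∸ 1))
oddsFibre (x ∷ y ∷ r) = cartesianProductWith (λ m t → x ∷ m ∷ t) (interval y (x ∸ y)) (oddsFibre (y ∷ r))

oddsFibre-sound : ∀ {b z} → IsPartition b → z ∈ oddsFibre b → IsPartition z × odds z ≡ b
oddsFibre-sound {[]}     _ (here refl) = partition-[] , refl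
oddsFibre-sound {x ∷ []} p (here refl) = p , refl
oddsFibre-sound {x ∷ []} (_ , x>0 ∷ []) (there z∈) with ∈-map⁻ _ z∈
... | m , m∈ , refl with ∈-interval⁻ m∈
... | m>0 , m≤top = partition-cons (top-≤ x>0 m≤top) (Linked.[-] , m>0 ∷ []) , refl
oddsFibre-sound {x ∷ y ∷ r} p z∈
  with ∈-cartesianProductWith⁻ _ (interval y (x ∸ y)) (oddsFibre (y ∷ r)) z∈
... | m , t , m∈ , t∈ , refl with oddsFibre-sound (partition-tail p) t∈ | ∈-interval⁻ m∈
... | pt , odds-t | y≤m , m≤top with odds-head odds-t
... | _ , refl =
  partition-cons (top-≤ (Linked.head (proj₁ p)) m≤top) (partition-cons y≤m pt) , cong (x ∷_) odds-t

oddsFibre-complete : ∀ {z} → IsPartition z → IsPartition (odds z) × z ∈ oddsFibre (odds z)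
oddsFibre-complete {[]}         _ = partition-[] , here refl
oddsFibre-complete {x ∷ []}     p = p , here refl
oddsFibre-complete {x ∷ m ∷ []} ((m≤x ∷ _) , x>0 ∷ m>0 ∷ []) =
  (Linked.[-] , x>0 ∷ []) , there (∈-map⁺ _ (∈-interval⁺ m>0 (≤-top x>0 m≤x)))
oddsFibre-complete {x ∷ m ∷ w ∷ r} p@((m≤x ∷ w≤m ∷ _) , _) with oddsFibre-complete (partition-tail (partition-tail p))
... | pw , w∈ =
  partition-cons w≤x pw ,
  ∈-cartesianProductWith⁺ (λ m t → x ∷ m ∷ t) (∈-interval⁺ w≤m (≤-top w≤x m≤x)) w∈
  where
  w≤x = ≤-trans w≤m m≤x

oddsFibre-unique : ∀ b → Unique (oddsFibre b)
oddsFibre-unique []          = [] ∷ []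
oddsFibre-unique (x ∷ [])    =
  All.tabulate notSingleton ∷ Unique.map⁺ (proj₁ ∘ prepend₂-injective x) (Unique-interval 1 (x ∸ 1))
  where
  notSingleton : ∀ {v} → v ∈ map (λ m → x ∷ m ∷ []) (interval 1 (x ∸ 1)) → x ∷ [] ≢ v
  notSingleton v∈ with ∈-map⁻ _ v∈
  ... | _ , _ , refl = λ ()
oddsFibre-unique (x ∷ y ∷ r) =
  Unique.cartesianProductWith⁺ _ (prepend₂-injective x) (Unique-interval y (x ∸ y)) (oddsFibre-unique (y ∷ r))

oddsFibre-size : ∀ {b} → IsPartition b → length (oddsFibre b) ≡ ω00 b
oddsFibre-size {[]}     _ = refl
oddsFibre-size {x ∷ []} (_ , x>0 ∷ []) = begin
  suc (length (map (λ m → x ∷ m ∷ []) (interval 1 (x ∸ 1))))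
    ≡⟨ cong suc (trans (length-map _ (interval 1 (x ∸ 1))) (length-interval 1 (x ∸ 1))) ⟩
  suc (suc (x ∸ 1))
    ≡⟨ cong suc (m+[n∸m]≡n x>0) ⟩
  suc x
    ≡⟨ +-comm 1 x ⟩
  x + 1 ∎
  where open ≡-Reasoning
oddsFibre-size {x ∷ y ∷ r} p = begin
  length (cartesianProductWith _ (interval y (x ∸ y)) (oddsFibre (y ∷ r)))
    ≡⟨ length-cartesianProductWith _ (interval y (x ∸ y)) (oddsFibre (y ∷ r)) ⟩
  length (interval y (x ∸ y)) * length (oddsFibre (y ∷ r))
    ≡⟨ cong₂ _*_ (trans (length-interval y (x ∸ y)) (+-comm 1 (x ∸ y))) (oddsFibre-size (partition-tail p)) ⟩
  (x ∸ y + 1) * ω00 (y ∷ r) ∎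
  where open ≡-Reasoning

oddsFibration : Fibration IsPartition IsPartition ω00
oddsFibration = record
  { base           = odds
  ; fibre          = oddsFibre
  ; fibre-sound    = oddsFibre-sound
  ; fibre-complete = oddsFibre-complete
  ; fibre-unique   = λ {b} _ → oddsFibre-unique b
  ; fibre-size     = oddsFibre-size
  }

identity₁ : ∀ n → CoeffEq IsPartition O IsPartition ω00 n
identity₁ n = coeffEq-fibration oddsFibration O (λ {z} _ → oddSum≡size-odds z) n
                (proj₂ (enumerate-bySize isPartition? proj₂ n))

largest : List ℕ → ℕ
largest = foldr _⊔_ 0

count : List ℕ → ℕ → ℕ
count π j = length (filter (j ≤?_) π)

conj-applyUpTo : ∀ π → conj π ≡ applyUpTo (count π ∘ suc) (largest π)
conj-applyUpTo π =
  trans (sym (map-∘ {g = count π} {f = suc} (upTo (largest π)))) (map-upTo (count π ∘ suc) (largest π))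

length-conj : ∀ π → length (conj π) ≡ largest π
length-conj π = trans (cong length (conj-applyUpTo π)) (length-applyUpTo _ (largest π))

applyUpTo-+ : {A : Set} (f : ℕ → A) (b c : ℕ) →
  applyUpTo f (b + c) ≡ applyUpTo f b ++ applyUpTo (f ∘ (b +_)) c
applyUpTo-+ f zero    c = refl
applyUpTo-+ f (suc b) c = cong (f 0 ∷_) (applyUpTo-+ (f ∘ suc) b c)

applyUpTo-congOn : {A : Set} (f g : ℕ → A) (n : ℕ) →
  (∀ {i} → i < n → f i ≡ g i) → applyUpTo f n ≡ applyUpTo g n
applyUpTo-congOn f g zero    f≡g = refl
applyUpTo-congOn f g (suc n) f≡g =
  cong₂ _∷_ (f≡g (s≤s z≤n)) (applyUpTo-congOn (f ∘ suc) (g ∘ suc) n (f≡g ∘ s≤s))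

applyUpTo-const : {A : Set} (x : A) (c : ℕ) → applyUpTo (λ _ → x) c ≡ replicate c x
applyUpTo-const x zero    = refl
applyUpTo-const x (suc c) = cong (x ∷_) (applyUpTo-const x c)

count-accept : ∀ {j x} π → j ≤ x → count (x ∷ π) j ≡ suc (count π j)
count-accept {j} π j≤x = cong length (filter-accept (j ≤?_) {xs = π} j≤x)

count-reject : ∀ {j x} π → x < j → count (x ∷ π) j ≡ count π j
count-reject {j} π x<j = cong length (filter-reject (j ≤?_) {xs = π} (<⇒≱ x<j))

count-++ : ∀ xs ys j → count (xs ++ ys) j ≡ count xs j + count ys j
count-++ xs ys j = trans (cong length (filter-++ (j ≤?_) xs ys)) (length-++ (filter (j ≤?_) xs))

count-map-suc : ∀ σ j → count (map suc σ) (suc j) ≡ count σ j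
count-map-suc []      j = refl
count-map-suc (x ∷ σ) j with j ≤? x
... | yes j≤x = trans (count-accept (map suc σ) (s≤s j≤x)) (trans (cong suc (count-map-suc σ j)) (sym (count-accept σ j≤x)))
... | no  j≰x = trans (count-reject (map suc σ) (s≤s (≰⇒> j≰x))) (trans (count-map-suc σ j) (sym (count-reject σ (≰⇒> j≰x))))

count-zero : ∀ σ → count σ 0 ≡ length σ
count-zero σ = cong length (filter-all (0 ≤?_) {σ} (All.tabulate (λ _ → z≤n)))

count-ones : ∀ c → count (replicate c 1) 1 ≡ c
count-ones zero    = refl
count-ones (suc c) = cong suc (count-ones c)

count-ones-beyond : ∀ c j → count (replicate c 1) (suc (suc j)) ≡ 0
count-ones-beyond zero    j = refl
count-ones-beyond (suc c) j = count-ones-beyond c j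

entries≤largest : ∀ π → All (_≤ largest π) π
entries≤largest []      = []
entries≤largest (x ∷ π) =
  m≤m⊔n x (largest π) ∷ All.map (λ y≤ → ≤-trans y≤ (m≤n⊔m x (largest π))) (entries≤largest π)

count-beyond : ∀ π {j} → largest π < j → count π j ≡ 0
count-beyond π {j} largest<j =
  cong length (filter-none (j ≤?_) (All.map (λ x≤ → <⇒≱ (≤-<-trans x≤ largest<j)) (entries≤largest π)))

largest-tail : ∀ {a π} → Linked _≥_ (a ∷ π) → largest π ≤ a
largest-tail {a} {[]}    _              = z≤n
largest-tail {a} {y ∷ π} (a≥y ∷ sorted) = ⊔-lub a≥y (≤-trans (largest-tail sorted) a≥y)

largest-head : ∀ {a π} → Linked _≥_ (a ∷ π) → largest (a ∷ π) ≡ a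
largest-head sorted = m≥n⇒m⊔n≡m (largest-tail sorted)

-- Conjugating after prepending a largest part a: each old column grows by one and
-- a ∸ largest π new columns of height 1 appear.
conj-cons : ∀ a π → largest π ≤ a → conj (a ∷ π) ≡ map suc (conj π) ++ replicate (a ∸ largest π) 1
conj-cons a π b≤a = begin
  conj (a ∷ π)
    ≡⟨ conj-applyUpTo (a ∷ π) ⟩
  applyUpTo F (a ⊔ b)
    ≡⟨ cong (applyUpTo F) (trans (m≥n⇒m⊔n≡m b≤a) (sym (m+[n∸m]≡n b≤a))) ⟩
  applyUpTo F (b + (a ∸ b))
    ≡⟨ applyUpTo-+ F b (a ∸ b) ⟩
  applyUpTo F b ++ applyUpTo (F ∘ (b +_)) (a ∸ b)
    ≡⟨ cong₂ _++_ oldColumns newColumns ⟩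
  map suc (conj π) ++ replicate (a ∸ b) 1 ∎
  where
  open ≡-Reasoning
  b = largest π
  F = count (a ∷ π) ∘ suc
  oldColumns : applyUpTo F b ≡ map suc (conj π)
  oldColumns = begin
    applyUpTo F b
      ≡⟨ applyUpTo-congOn F (suc ∘ count π ∘ suc) b (λ i<b → count-accept π (≤-trans i<b b≤a)) ⟩
    applyUpTo (suc ∘ count π ∘ suc) b
      ≡⟨ sym (map-applyUpTo (count π ∘ suc) suc b) ⟩
    map suc (applyUpTo (count π ∘ suc) b)
      ≡⟨ cong (map suc) (sym (conj-applyUpTo π)) ⟩
    map suc (conj π) ∎
  newColumn : ∀ {i} → i < a ∸ b → F (b + i) ≡ 1
  newColumn {i} i<a∸b = begin
    count (a ∷ π) (suc (b + i))
      ≡⟨ count-accept π (≤-trans (+-monoʳ-< b i<a∸b) (≤-reflexive (m+[n∸m]≡n b≤a))) ⟩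
    suc (count π (suc (b + i)))
      ≡⟨ cong suc (count-beyond π (s≤s (m≤m+n b i))) ⟩
    1 ∎
  newColumns : applyUpTo (F ∘ (b +_)) (a ∸ b) ≡ replicate (a ∸ b) 1
  newColumns = trans (applyUpTo-congOn _ (λ _ → 1) (a ∸ b) newColumn) (applyUpTo-const 1 (a ∸ b))

largest-++ : ∀ xs ys → largest (xs ++ ys) ≡ largest xs ⊔ largest ys
largest-++ []       ys = refl
largest-++ (x ∷ xs) ys = trans (cong (x ⊔_) (largest-++ xs ys)) (sym (⊔-assoc x (largest xs) (largest ys)))

largest-map-suc : ∀ x σ → largest (map suc (x ∷ σ)) ≡ suc (largest (x ∷ σ))
largest-map-suc x []      = trans (⊔-identityʳ (suc x)) (cong suc (sym (⊔-identityʳ x)))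
largest-map-suc x (y ∷ σ) = cong (suc x ⊔_) (largest-map-suc y σ)

largest-ones≤1 : ∀ c → largest (replicate c 1) ≤ 1
largest-ones≤1 zero    = z≤n
largest-ones≤1 (suc c) = ⊔-lub ≤-refl (largest-ones≤1 c)

largest-shift : ∀ σ c → 0 < length σ + c → largest (map suc σ ++ replicate c 1) ≡ suc (largest σ)
largest-shift []      (suc c) _ = m≥n⇒m⊔n≡m (largest-ones≤1 c)
largest-shift (x ∷ σ) c       _ = begin
  largest (map suc (x ∷ σ) ++ replicate c 1)
    ≡⟨ largest-++ (map suc (x ∷ σ)) (replicate c 1) ⟩
  largest (map suc (x ∷ σ)) ⊔ largest (replicate c 1)
    ≡⟨ cong (_⊔ largest (replicate c 1)) (largest-map-suc x σ) ⟩
  suc (largest (x ∷ σ)) ⊔ largest (replicate c 1)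
    ≡⟨ m≥n⇒m⊔n≡m (≤-trans (largest-ones≤1 c) (s≤s z≤n)) ⟩
  suc (largest (x ∷ σ)) ∎
  where open ≡-Reasoning

conj-shift : ∀ σ c → 0 < length σ + c → conj (map suc σ ++ replicate c 1) ≡ (length σ + c) ∷ conj σ
conj-shift σ c nonempty = begin
  conj L
    ≡⟨ conj-applyUpTo L ⟩
  applyUpTo (count L ∘ suc) (largest L)
    ≡⟨ cong (applyUpTo (count L ∘ suc)) (largest-shift σ c nonempty) ⟩
  count L 1 ∷ applyUpTo (count L ∘ suc ∘ suc) (largest σ)
    ≡⟨ cong₂ _∷_ firstColumn (applyUpTo-congOn _ _ (largest σ) (λ {i} _ → laterColumn i)) ⟩
  (length σ + c) ∷ applyUpTo (count σ ∘ suc) (largest σ)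
    ≡⟨ cong ((length σ + c) ∷_) (sym (conj-applyUpTo σ)) ⟩
  (length σ + c) ∷ conj σ ∎
  where
  open ≡-Reasoning
  L = map suc σ ++ replicate c 1
  firstColumn : count L 1 ≡ length σ + c
  firstColumn = trans (count-++ (map suc σ) (replicate c 1) 1)
                      (cong₂ _+_ (trans (count-map-suc σ 0) (count-zero σ)) (count-ones c))
  laterColumn : ∀ i → count L (suc (suc i)) ≡ count σ (suc i)
  laterColumn i = trans (count-++ (map suc σ) (replicate c 1) (suc (suc i)))
                        (trans (cong₂ _+_ (count-map-suc σ (suc i)) (count-ones-beyond c i)) (+-identityʳ _))

conj-involutive : ∀ {π} → IsPartition π → conj (conj π) ≡ π
conj-involutive {[]}    _                         = refl
conj-involutive {a ∷ π} (sorted , a>0 ∷ positive) = begin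
  conj (conj (a ∷ π))
    ≡⟨ cong conj (conj-cons a π b≤a) ⟩
  conj (map suc (conj π) ++ replicate (a ∸ b) 1)
    ≡⟨ conj-shift (conj π) (a ∸ b) (≤-trans a>0 (≤-reflexive (sym firstPart))) ⟩
  (length (conj π) + (a ∸ b)) ∷ conj (conj π)
    ≡⟨ cong₂ _∷_ firstPart (conj-involutive (Linked.tail sorted , positive)) ⟩
  a ∷ π ∎
  where
  open ≡-Reasoning
  b = largest π
  b≤a = largest-tail sorted
  firstPart : length (conj π) + (a ∸ b) ≡ a
  firstPart = trans (cong (_+ (a ∸ b)) (length-conj π)) (m+[n∸m]≡n b≤a)

-- Rise x y: the part y exceeds the next part x by 0 or 1.
data Rise (x : ℕ) : ℕ → Set where
  flat : Rise x x
  up   : Rise x (suc x)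

rise-≤ : ∀ {x y} → Rise x y → x ≤ y
rise-≤ flat = ≤-refl
rise-≤ up   = n≤1+n _

rise-gap : ∀ {x y} → Rise x y → y ∸ x ≤ 1
rise-gap {x} flat = ≤-trans (≤-reflexive (n∸n≡0 x)) z≤n
rise-gap {x} up   = ≤-reflexive (m+n∸n≡m 1 x)

rise-suc : ∀ {x y} → Rise x y → Rise (suc x) (suc y)
rise-suc flat = flat
rise-suc up   = up

rise₂-gap : ∀ {w m x} → Rise w m → Rise m x → x ∸ w ≤ 2
rise₂-gap {w} flat flat = ≤-trans (≤-reflexive (n∸n≡0 w)) z≤n
rise₂-gap {w} flat up   = ≤-trans (≤-reflexive (m+n∸n≡m 1 w)) (s≤s z≤n)
rise₂-gap {w} up   flat = ≤-trans (≤-reflexive (m+n∸n≡m 1 w)) (s≤s z≤n)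
rise₂-gap {w} up   up   = ≤-reflexive (m+n∸n≡m 2 w)

-- Compact partitions: the smallest part is 1 and consecutive parts differ by at
-- most 1.  They are exactly the conjugates of the partitions into distinct parts.
data Compact : List ℕ → Set where
  empty  : Compact []
  single : Compact (1 ∷ [])
  rise   : ∀ {x y r} → Rise x y → Compact (x ∷ r) → Compact (y ∷ x ∷ r)

compact-partition : ∀ {ρ} → Compact ρ → IsPartition ρ
compact-partition empty      = partition-[]
compact-partition single     = Linked.[-] , s≤s z≤n ∷ []
compact-partition (rise ρ c) = partition-cons (rise-≤ ρ) (compact-partition c)

compact-ones : ∀ k → Compact (replicate (suc k) 1)
compact-ones zero    = single
compact-ones (suc k) = rise flat (compact-ones k)

compact-raise++ : ∀ {σ τ} → Compact σ → Compact (1 ∷ τ) → Compact (map suc σ ++ 1 ∷ τ)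
compact-raise++ empty      c₁ = c₁
compact-raise++ single     c₁ = rise up c₁
compact-raise++ (rise ρ c) c₁ = rise (rise-suc ρ) (compact-raise++ c c₁)

largest-strict : ∀ {a π} → 0 < a → Linked _≥_ (a ∷ π) → Linked _>_ (a ∷ π) → largest π < a
largest-strict {π = []}    a>0 _             _         = a>0
largest-strict {π = _ ∷ _} _   (_ ∷ sorted) (a>y ∷ _) = subst (_< _) (sym (largest-head sorted)) a>y

-- The conjugate of a partition into distinct parts is compact: by conj-cons, each
-- new largest part a > largest π adds at least one column of height 1.
distinct⇒compact-conj : ∀ {π} → IsDistinct π → Compact (conj π)
distinct⇒compact-conj {[]}    _ = empty
distinct⇒compact-conj {a ∷ π} ((sorted , a>0 ∷ positive) , strict) =
  subst Compact (sym conj≡) (compact-raise++ (distinct⇒compact-conj ((Linked.tail sorted , positive) , Linked.tail strict))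
                                             (compact-ones (a ∸ largest π ∸ 1)))
  where
  largest<a : largest π < a
  largest<a = largest-strict a>0 sorted strict
  conj≡ : conj (a ∷ π) ≡ map suc (conj π) ++ replicate (suc (a ∸ largest π ∸ 1)) 1
  conj≡ = trans (conj-cons a π (<⇒≤ largest<a))
                (cong (λ c → map suc (conj π) ++ replicate c 1) (sym (m+[n∸m]≡n (m<n⇒0<n∸m largest<a))))

strict⇒distinct : ∀ {D} → Linked _>_ D → All (0 <_) D → IsDistinct D
strict⇒distinct strict positive = (Linked.map <⇒≤ strict , positive) , strict

raise++ones-positive : ∀ D c → All (0 <_) (map suc D ++ replicate c 1)
raise++ones-positive []      zero    = []
raise++ones-positive []      (suc c) = s≤s z≤n ∷ raise++ones-positive [] c
raise++ones-positive (d ∷ D) c       = s≤s z≤n ∷ raise++ones-positive D c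

raise++ones-strict : ∀ {D c} → c ≤ 1 → Linked _>_ D → All (0 <_) D → Linked _>_ (map suc D ++ replicate c 1)
raise++ones-strict {[]}          z≤n       _            _                = []
raise++ones-strict {[]}          (s≤s z≤n) _            _                = [-]
raise++ones-strict {d ∷ []}      z≤n       _            _                = [-]
raise++ones-strict {d ∷ []}      (s≤s z≤n) _            (d>0 ∷ [])       = s≤s d>0 ∷ [-]
raise++ones-strict {d ∷ e ∷ D}   c≤1       (d>e ∷ strict) (_ ∷ positive) = s≤s d>e ∷ raise++ones-strict c≤1 strict positive

-- The conjugate of a compact partition has distinct parts: by conj-cons, each rise
-- of 0 or 1 adds at most one column of height 1.
compact⇒distinct-conj : ∀ {ρ} → Compact ρ → IsDistinct (conj ρ)
compact⇒distinct-conj empty  = partition-[] , []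
compact⇒distinct-conj single = (Linked.[-] , s≤s z≤n ∷ []) , Linked.[-]
compact⇒distinct-conj (rise {x} {y} {r} ρ c) with compact⇒distinct-conj c
... | ((_ , positive) , strict) =
  subst IsDistinct (sym conj≡)
    (strict⇒distinct (raise++ones-strict (rise-gap ρ) strict positive)
                     (raise++ones-positive (conj (x ∷ r)) (y ∸ x)))
  where
  x-largest : largest (x ∷ r) ≡ x
  x-largest = largest-head (proj₁ (compact-partition c))
  conj≡ : conj (y ∷ x ∷ r) ≡ map suc (conj (x ∷ r)) ++ replicate (y ∸ x) 1
  conj≡ = trans (conj-cons y (x ∷ r) (≤-trans (≤-reflexive x-largest) (rise-≤ ρ)))
                (cong (λ b → map suc (conj (x ∷ r)) ++ replicate (y ∸ b) 1) x-largest)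

-- The values m with Rise y m and Rise m x, where d = x ∸ y: one value for
-- d = 0 or d = 2, two for d = 1, none for d > 2.
middles : ℕ → ℕ → List ℕ
middles y 0 = y ∷ []
middles y 1 = suc y ∷ y ∷ []
middles y 2 = suc y ∷ []
middles y _ = []

middles-sound : ∀ {y x m} → y ≤ x → m ∈ middles y (x ∸ y) → Rise y m × Rise m x
middles-sound {y} {x} y≤x m∈ = subst (λ z → Rise y _ × Rise _ z) (m∸n+n≡m y≤x) (rises (x ∸ y) m∈)
  where
  rises : ∀ d {m} → m ∈ middles y d → Rise y m × Rise m (d + y)
  rises 0 (here refl)         = flat , flat
  rises 1 (here refl)         = up , flat
  rises 1 (there (here refl)) = flat , up
  rises 2 (here refl)         = up , up

middles-complete : ∀ {y m x} → Rise y m → Rise m x → m ∈ middles y (x ∸ y)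
middles-complete {y} flat flat rewrite n∸n≡0 y     = here refl
middles-complete {y} flat up   rewrite m+n∸n≡m 1 y = there (here refl)
middles-complete {y} up   flat rewrite m+n∸n≡m 1 y = here refl
middles-complete {y} up   up   rewrite m+n∸n≡m 2 y = here refl

middles-unique : ∀ y d → Unique (middles y d)
middles-unique y 0                   = [] ∷ []
middles-unique y 1                   = ((λ ()) ∷ []) ∷ [] ∷ []
middles-unique y 2                   = [] ∷ []
middles-unique y (suc (suc (suc d))) = []

middles-size : ∀ y {d} → d ≤ 2 → length (middles y d) ≡ 2 ^ par d
middles-size y {0} _ = refl
middles-size y {1} _ = refl
middles-size y {2} _ = refl
middles-size y {suc (suc (suc d))} (s≤s (s≤s ()))

smallestAtMost2? : Decidable SmallestAtMost2
smallestAtMost2? []          = yes tt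
smallestAtMost2? (x ∷ [])    = x ≤? 2
smallestAtMost2? (x ∷ y ∷ r) = smallestAtMost2? (y ∷ r)

inK? : Decidable InK
inK? π = isPartition? π ×-dec (linked? (λ a b → a ∸ b ≤? 2) π ×-dec smallestAtMost2? π)

inK-tail : ∀ {x r} → InK (x ∷ r) → InK r
inK-tail {r = []}    _                          = partition-[] , [] , tt
inK-tail {r = _ ∷ _} (p , (_ ∷ gaps) , smallest) = partition-tail p , gaps , smallest

inK-cons : ∀ {x w ρ} → w ≤ x → x ∸ w ≤ 2 → InK (w ∷ ρ) → InK (x ∷ w ∷ ρ)
inK-cons w≤x gap (p , gaps , smallest) = partition-cons w≤x p , gap ∷ gaps , smallest

-- The compact partitions with odd-indexed parts b ∈ 𝒦: between consecutive odd parts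
-- x ≥ y the even part is one of  middles y (x ∸ y), and the last odd part x is
-- followed by a final 1 (x = 1 or x = 2) or ends the partition (x = 1).
-- This gives ω̂₁(b) choices.
lastFibre : ℕ → List (List ℕ)
lastFibre 1 = (1 ∷ []) ∷ (1 ∷ 1 ∷ []) ∷ []
lastFibre 2 = (2 ∷ 1 ∷ []) ∷ []
lastFibre _ = []

compactFibre : List ℕ → List (List ℕ)
compactFibre []          = [] ∷ []
compactFibre (x ∷ [])    = lastFibre x
compactFibre (x ∷ y ∷ r) = cartesianProductWith (λ m t → x ∷ m ∷ t) (middles y (x ∸ y)) (compactFibre (y ∷ r))

compactFibre-sound : ∀ {b z} → InK b → z ∈ compactFibre b → Compact z × odds z ≡ b
compactFibre-sound {[]}     _ (here refl)         = empty , refl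
compactFibre-sound {1 ∷ []} _ (here refl)         = single , refl
compactFibre-sound {1 ∷ []} _ (there (here refl)) = rise flat single , refl
compactFibre-sound {2 ∷ []} _ (here refl)         = rise up single , refl
compactFibre-sound {x ∷ y ∷ r} k z∈
  with ∈-cartesianProductWith⁻ _ (middles y (x ∸ y)) (compactFibre (y ∷ r)) z∈
... | m , t , m∈ , t∈ , refl with compactFibre-sound (inK-tail k) t∈
... | ct , odds-t with odds-head odds-t | middles-sound (Linked.head (proj₁ (proj₁ k))) m∈
... | _ , refl | y↗m , m↗x = rise m↗x (rise y↗m ct) , cong (x ∷_) odds-t

compactFibre-complete : ∀ {z} → Compact z → InK (odds z) × z ∈ compactFibre (odds z)
compactFibre-complete empty               = (partition-[] , [] , tt) , here refl
compactFibre-complete single              = ((Linked.[-] , s≤s z≤n ∷ []) , [-] , s≤s z≤n) , here refl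
compactFibre-complete (rise flat single)  = ((Linked.[-] , s≤s z≤n ∷ []) , [-] , s≤s z≤n) , there (here refl)
compactFibre-complete (rise up single)    = ((Linked.[-] , s≤s z≤n ∷ []) , [-] , s≤s (s≤s z≤n)) , here refl
compactFibre-complete (rise {y = x} m↗x (rise {x = w} w↗m c)) with compactFibre-complete c
... | k , w∈ =
  inK-cons (≤-trans (rise-≤ w↗m) (rise-≤ m↗x)) (rise₂-gap w↗m m↗x) k ,
  ∈-cartesianProductWith⁺ (λ m t → x ∷ m ∷ t) (middles-complete w↗m m↗x) w∈

compactFibre-unique : ∀ b → Unique (compactFibre b)
compactFibre-unique []                        = [] ∷ []
compactFibre-unique (0 ∷ [])                  = []
compactFibre-unique (1 ∷ [])                  = ((λ ()) ∷ []) ∷ [] ∷ []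
compactFibre-unique (2 ∷ [])                  = [] ∷ []
compactFibre-unique (suc (suc (suc _)) ∷ [])  = []
compactFibre-unique (x ∷ y ∷ r) =
  Unique.cartesianProductWith⁺ _ (prepend₂-injective x) (middles-unique y (x ∸ y)) (compactFibre-unique (y ∷ r))

compactFibre-size : ∀ {b} → InK b → length (compactFibre b) ≡ ωhat1 b
compactFibre-size {[]}     _ = refl
compactFibre-size {0 ∷ []} ((_ , () ∷ _) , _)
compactFibre-size {1 ∷ []} _ = refl
compactFibre-size {2 ∷ []} _ = refl
compactFibre-size {suc (suc (suc _)) ∷ []} (_ , _ , s≤s (s≤s ()))
compactFibre-size {x ∷ y ∷ r} k@(_ , (gap ∷ _) , _) = begin
  length (cartesianProductWith _ (middles y (x ∸ y)) (compactFibre (y ∷ r)))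
    ≡⟨ length-cartesianProductWith _ (middles y (x ∸ y)) (compactFibre (y ∷ r)) ⟩
  length (middles y (x ∸ y)) * length (compactFibre (y ∷ r))
    ≡⟨ cong₂ _*_ (middles-size y gap) (compactFibre-size (inK-tail k)) ⟩
  2 ^ par (x ∸ y) * ωhat1 (y ∷ r) ∎
  where open ≡-Reasoning

-- Partitions into distinct parts fibre over 𝒦 via π ↦ odds (π′), with fibre sizes ω̂₁:
-- conjugation identifies them with compact partitions, which fibre over their odd parts.
conjOddsFibration : Fibration IsDistinct InK ωhat1
conjOddsFibration = record
  { base           = odds ∘ conj
  ; fibre          = map conj ∘ compactFibre
  ; fibre-sound    = sound
  ; fibre-complete = complete
  ; fibre-unique   = λ {b} k → Unique-map-injectiveOn conj (conj-injectiveOn k) (compactFibre-unique b)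
  ; fibre-size     = λ {b} k → trans (length-map conj (compactFibre b)) (compactFibre-size k)
  }
  where
  involutive : ∀ {ρ} → Compact ρ → conj (conj ρ) ≡ ρ
  involutive = conj-involutive ∘ compact-partition
  sound : ∀ {b z} → InK b → z ∈ map conj (compactFibre b) → IsDistinct z × odds (conj z) ≡ b
  sound k z∈ with ∈-map⁻ conj z∈
  ... | ρ , ρ∈ , refl with compactFibre-sound k ρ∈
  ... | c , odds-ρ = compact⇒distinct-conj c , trans (cong odds (involutive c)) odds-ρ
  complete : ∀ {z} → IsDistinct z → InK (odds (conj z)) × z ∈ map conj (compactFibre (odds (conj z)))
  complete {z} d with compactFibre-complete (distinct⇒compact-conj d)
  ... | k , ρ∈ = k , subst (_∈ map conj (compactFibre (odds (conj z)))) (conj-involutive (proj₁ d)) (∈-map⁺ conj ρ∈)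
  conj-injectiveOn : ∀ {b} → InK b → ∀ {ρ σ} → ρ ∈ compactFibre b → σ ∈ compactFibre b → conj ρ ≡ conj σ → ρ ≡ σ
  conj-injectiveOn k ρ∈ σ∈ eq =
    trans (sym (involutive (proj₁ (compactFibre-sound k ρ∈))))
          (trans (cong conj eq) (involutive (proj₁ (compactFibre-sound k σ∈))))

identity₂ : ∀ n → CoeffEq IsDistinct (λ π → O (conj π)) InK ωhat1 n
identity₂ n = coeffEq-fibration conjOddsFibration (O ∘ conj) (λ {z} _ → oddSum≡size-odds (conj z)) n
                (proj₂ (enumerate-bySize inK? (proj₂ ∘ proj₁) n))

corollary13 : ((n : ℕ) → CoeffEq IsPartition O IsPartition ω00 n)
            × ((n : ℕ) → CoeffEq IsDistinct (λ π → O (conj π)) InK ωhat1 n)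
corollary13 = identity₁ , identity₂
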